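{- For all integers $n,m\ge 2$, $\lambda_2(\overrightarrow{C}_n\Box \overrightarrow{C}_m)=2$.
   Context: $\overrightarrow{C}_n$ denotes the directed cycle of order $n$. For a digraph $D$ and $S\subseteq V(D)$, an $S$-strong subgraph is a strongly connected subgraph of $D$ containing all vertices of $S$; $\lambda_S(D)$ is the maximum number of pairwise arc-disjoint $S$-strong subgraphs of $D$; and $\lambda_2(D)=\min\{\lambda_S(D): S\subseteq V(D),\ |S|=2\}$. The Cartesian product $G\Box H$ has vertex set $V(G)\times V(H)$, and $(x,x')(y,y')$ is an arc iff either $xy\in A(G)$ and $x'=y'$, or $x=y$ and $x'y'\in A(H)$. -}

module Defs where

open import Level using (Level; _⊔_; suc)
open import Data.Nat using (ℕ; zero; _∸_) renaming (suc to sucℕ)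
open import Data.Fin using (Fin; toℕ)
open import Data.Product using (Σ; _×_; _,_; ∃-syntax)
open import Data.Sum using (_⊎_)
open import Relation.Binary.PropositionalEquality using (_≡_; _≢_)
open import Relation.Nullary using (¬_)

-- A digraph: vertex type and arc relation (an arc is identified by its
-- ordered pair of endpoints; no parallel arcs).
record Digraph : Set₁ where
  field
    V   : Set
    Arc : V → V → Set
open Digraph public

cycleArc : (n : ℕ) → Fin n → Fin n → Set
cycleArc n i j = (toℕ j ≡ sucℕ (toℕ i)) ⊎ ((toℕ i ≡ n ∸ 1) × (toℕ j ≡ 0))

Cycle : ℕ → Digraph
Cycle n = record { V = Fin n ; Arc = cycleArc n }

_□_ : Digraph → Digraph → Digraph
G □ H = record
  { V   = V G × V H
  ; Arc = λ { (x , x′) (y , y′) → (Arc G x y × x′ ≡ y′) ⊎ (x ≡ y × Arc H x′ y′) }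
  }

record Subgraph (D : Digraph) : Set₁ where
  field
    VS     : V D → Set
    AS     : V D → V D → Set
    AS⊆A   : ∀ {u v} → AS u v → Arc D u v
    AS-src : ∀ {u v} → AS u v → VS u
    AS-tgt : ∀ {u v} → AS u v → VS v
open Subgraph public

data Walk {A : Set} (R : A → A → Set) : A → A → Set where
  here : ∀ {u} → Walk R u u
  step : ∀ {u v w} → R u v → Walk R v w → Walk R u w

StronglyConnected : {D : Digraph} → Subgraph D → Set
StronglyConnected H = ∀ u v → VS H u → VS H v → Walk (AS H) u v

PairStrong : (D : Digraph) → V D → V D → Subgraph D → Set
PairStrong D x y H = VS H x × VS H y × StronglyConnected H

HasPacking : (D : Digraph) → V D → V D → ℕ → Set₁
HasPacking D x y k =
  Σ (Fin k → Subgraph D) λ H →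
    (∀ i → PairStrong D x y (H i)) ×
    (∀ i j → i ≢ j → ∀ u v → ¬ (AS (H i) u v × AS (H j) u v))

-- λ_2(D) = k : every 2-subset S has λ_S(D) ≥ k, and some 2-subset S has
-- λ_S(D) < k+1.
Lambda2≡ : Digraph → ℕ → Set₁
Lambda2≡ D k =
  (∀ x y → x ≢ y → HasPacking D x y k) ×
  (∃[ x ] ∃[ y ] (x ≢ y × ¬ HasPacking D x y (sucℕ k)))

-- Lower bound: for x ≠ y in G □ H with G, H strong and loopless, take two unions of
-- rows and columns, each strongly connected through a hub vertex and containing x and y,
-- using disjoint rows and disjoint columns; a row arc and a column arc never coincide
-- because G has no loops.  Upper bound: (0,0) has only two out-arcs in C_n □ C_m, and every
-- {(0,0),(1,0)}-strong subgraph must use one of them, so three such subgraphs cannot be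
-- arc-disjoint.
module Submission where

open import Defs
open import Data.Nat using (ℕ; _≤_; _<_; zero; suc; _+_; _∸_; s≤s; z≤n)
open import Data.Nat.Properties using (≤-trans; +-suc; +-identityʳ; m≤n+m; m∸n+n≡m; 1+n≢n)
open import Data.Fin using (Fin; toℕ; fromℕ; fromℕ<; _≟_) renaming (zero to fzero; suc to fsuc)
open import Data.Fin.Properties using (toℕ-injective; toℕ<n; toℕ≤pred[n]; toℕ-fromℕ; toℕ-fromℕ<)
open import Data.Product using (∃; _×_; _,_)
open import Data.Sum using (_⊎_; inj₁; inj₂)
open import Data.Empty using (⊥; ⊥-elim)
open import Relation.Nullary using (¬_; yes; no)
open import Relation.Binary.Definitions using (DecidableEquality)
open import Relation.Binary.PropositionalEquality
  using (_≡_; _≢_; refl; sym; trans; cong; subst; ≢-sym)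

infixr 5 _++ʷ_

_++ʷ_ : ∀ {A : Set} {R : A → A → Set} {u v w} → Walk R u v → Walk R v w → Walk R u w
here       ++ʷ w = w
step a w₁ ++ʷ w = step a (w₁ ++ʷ w)

map-walk : ∀ {A B : Set} {R : A → A → Set} {S : B → B → Set} (f : A → B) →
           (∀ {u v} → R u v → S (f u) (f v)) → ∀ {u v} → Walk R u v → Walk S (f u) (f v)
map-walk f g here       = here
map-walk f g (step a w) = step (g a) (map-walk f g w)

first-arc : ∀ {A : Set} {R : A → A → Set} {x y} → x ≢ y → Walk R x y → ∃ λ v → R x v
first-arc x≢y here             = ⊥-elim (x≢y refl)
first-arc x≢y (step {v = v} a _) = v , a

Strong : Digraph → Set
Strong G = ∀ u v → Walk (Arc G) u v

Loopless : Digraph → Set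
Loopless G = ∀ {u} → ¬ Arc G u u

NonTrivial : Set → Set
NonTrivial A = ∀ (a : A) → ∃ λ b → b ≢ a

cycle-walk-up : ∀ {K} d (i j : Fin K) → toℕ j ≡ d + toℕ i → Walk (cycleArc K) i j
cycle-walk-up zero    i j j≡i   = subst (Walk _ i) (toℕ-injective (sym j≡i)) here
cycle-walk-up {K} (suc d) i j j≡d+1+i =
  step (inj₁ (toℕ-fromℕ< 1+i<K)) (cycle-walk-up d (fromℕ< 1+i<K) j j≡d+i′)
  where
  1+i<K : suc (toℕ i) < K
  1+i<K = ≤-trans (s≤s (subst (suc (toℕ i) ≤_) (sym j≡d+1+i) (s≤s (m≤n+m (toℕ i) d))))
                  (toℕ<n j)
  j≡d+i′ : toℕ j ≡ d + toℕ (fromℕ< 1+i<K)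
  j≡d+i′ = trans j≡d+1+i (trans (sym (+-suc d (toℕ i))) (cong (d +_) (sym (toℕ-fromℕ< 1+i<K))))

cycle-strong : ∀ k → Strong (Cycle (suc k))
cycle-strong k i j =
  cycle-walk-up (k ∸ toℕ i) i (fromℕ k) (trans (toℕ-fromℕ k) (sym (m∸n+n≡m (toℕ≤pred[n] i))))
  ++ʷ step (inj₂ (toℕ-fromℕ k , refl)) (cycle-walk-up (toℕ j) fzero j (sym (+-identityʳ (toℕ j))))

-- C_1 has the loop 0 → 0, hence the order at least 2.
cycle-loopless : ∀ k → Loopless (Cycle (suc (suc k)))
cycle-loopless k (inj₁ i≡1+i)     = 1+n≢n (sym i≡1+i)
cycle-loopless k (inj₂ (i≡1+k , i≡0)) with trans (sym i≡1+k) i≡0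
... | ()

cycle-arc-from-zero : ∀ {k} {j : Fin (suc (suc k))} → cycleArc (suc (suc k)) fzero j → j ≡ fsuc fzero
cycle-arc-from-zero {j = fzero}        (inj₁ ())
cycle-arc-from-zero {j = fsuc fzero}    (inj₁ refl) = refl
cycle-arc-from-zero {j = fsuc (fsuc _)} (inj₁ ())
cycle-arc-from-zero                     (inj₂ (() , _))

fin-nonTrivial : ∀ k → NonTrivial (Fin (suc (suc k)))
fin-nonTrivial k fzero    = fsuc fzero , λ ()
fin-nonTrivial k (fsuc _) = fzero , λ ()

packing-of-two : ∀ {D x y} (H₁ H₂ : Subgraph D) → PairStrong D x y H₁ → PairStrong D x y H₂ →
                 (∀ u v → ¬ (AS H₁ u v × AS H₂ u v)) → HasPacking D x y 2
packing-of-two {D} {x} {y} H₁ H₂ s₁ s₂ disjoint = H , strong , pairwise-disjoint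
  where
  H : Fin 2 → Subgraph D
  H fzero    = H₁
  H (fsuc _) = H₂
  strong : ∀ i → PairStrong D x y (H i)
  strong fzero    = s₁
  strong (fsuc _) = s₂
  pairwise-disjoint : ∀ i j → i ≢ j → ∀ u v → ¬ (AS (H i) u v × AS (H j) u v)
  pairwise-disjoint fzero    fzero    i≢j = ⊥-elim (i≢j refl)
  pairwise-disjoint fzero    (fsuc _) i≢j = disjoint
  pairwise-disjoint (fsuc _) fzero    i≢j u v (a₂ , a₁) = disjoint u v (a₁ , a₂)
  pairwise-disjoint (fsuc fzero) (fsuc fzero) i≢j = ⊥-elim (i≢j refl)

-- Every {x,y}-strong subgraph contains an arc out of x, so λ_{x,y} is at most the out-degree of x.
¬packing-of-three-if-out-degree-two : ∀ {D x y z} → x ≢ y → (∀ {v} → Arc D x v → v ≡ y ⊎ v ≡ z) →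
                                      ¬ HasPacking D x y 3
¬packing-of-three-if-out-degree-two {D} {x} {y} {z} x≢y out (H , strong , disjoint)
  with exit fzero | exit (fsuc fzero) | exit (fsuc (fsuc fzero))
  where
  exit : ∀ i → AS (H i) x y ⊎ AS (H i) x z
  exit i with strong i
  ... | x∈H , y∈H , sc with first-arc x≢y (sc x y x∈H y∈H)
  ... | v , a with out (AS⊆A (H i) a)
  ... | inj₁ v≡y = inj₁ (subst (AS (H i) x) v≡y a)
  ... | inj₂ v≡z = inj₂ (subst (AS (H i) x) v≡z a)
... | inj₁ a | inj₁ b | _      = disjoint fzero (fsuc fzero) (λ ()) x y (a , b)
... | inj₂ a | inj₂ b | _      = disjoint fzero (fsuc fzero) (λ ()) x z (a , b)
... | inj₁ a | _      | inj₁ c = disjoint fzero (fsuc (fsuc fzero)) (λ ()) x y (a , c)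
... | inj₂ a | _      | inj₂ c = disjoint fzero (fsuc (fsuc fzero)) (λ ()) x z (a , c)
... | _      | inj₁ b | inj₁ c = disjoint (fsuc fzero) (fsuc (fsuc fzero)) (λ ()) x y (b , c)
... | _      | inj₂ b | inj₂ c = disjoint (fsuc fzero) (fsuc (fsuc fzero)) (λ ()) x z (b , c)

module _ {G H : Digraph} where

  -- lines R C is the union of the rows V G × {q} with R q and the columns {p} × V H with C p.
  LineArc : (V H → Set) → (V G → Set) → V (G □ H) → V (G □ H) → Set
  LineArc R C (p , q) (p′ , q′) = (Arc G p p′ × q ≡ q′ × R q) ⊎ (p ≡ p′ × Arc H q q′ × C p)

  OnLine : (V H → Set) → (V G → Set) → V (G □ H) → Set
  OnLine R C (p , q) = R q ⊎ C p

  lines : (V H → Set) → (V G → Set) → Subgraph (G □ H)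
  lines R C = record { VS = OnLine R C ; AS = LineArc R C ; AS⊆A = arc ; AS-src = src ; AS-tgt = tgt }
    where
    arc : ∀ {u v} → LineArc R C u v → Arc (G □ H) u v
    arc {_ , _} {_ , _} (inj₁ (a , q≡q′ , _)) = inj₁ (a , q≡q′)
    arc {_ , _} {_ , _} (inj₂ (p≡p′ , a , _)) = inj₂ (p≡p′ , a)
    src : ∀ {u v} → LineArc R C u v → OnLine R C u
    src {_ , _} {_ , _} (inj₁ (_ , _ , r)) = inj₁ r
    src {_ , _} {_ , _} (inj₂ (_ , _ , c)) = inj₂ c
    tgt : ∀ {u v} → LineArc R C u v → OnLine R C v
    tgt {_ , _} {_ , _} (inj₁ (_ , refl , r)) = inj₁ r
    tgt {_ , _} {_ , _} (inj₂ (refl , _ , c)) = inj₂ c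

  module _ {R : V H → Set} {C : V G → Set} where

    row-walk : Strong G → ∀ {q} → R q → ∀ p p′ → Walk (LineArc R C) (p , q) (p′ , q)
    row-walk strongG {q} r p p′ = map-walk (_, q) (λ a → inj₁ (a , refl , r)) (strongG p p′)

    column-walk : Strong H → ∀ {p} → C p → ∀ q q′ → Walk (LineArc R C) (p , q) (p , q′)
    column-walk strongH {p} c q q′ = map-walk (p ,_) (λ a → inj₂ (refl , a , c)) (strongH q q′)

    lines-strong : Strong G → Strong H → ∀ {q₀ p₀} → R q₀ → C p₀ → StronglyConnected (lines R C)
    lines-strong strongG strongH {q₀} {p₀} r₀ c₀ (p , q) (p′ , q′) u∈ v∈ = to-hub u∈ ++ʷ from-hub v∈
      where
      to-hub : OnLine R C (p , q) → Walk (LineArc R C) (p , q) (p₀ , q₀)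
      to-hub (inj₁ r) = row-walk strongG r p p₀ ++ʷ column-walk strongH c₀ q q₀
      to-hub (inj₂ c) = column-walk strongH c q q₀ ++ʷ row-walk strongG r₀ p p₀
      from-hub : OnLine R C (p′ , q′) → Walk (LineArc R C) (p₀ , q₀) (p′ , q′)
      from-hub (inj₁ r) = column-walk strongH c₀ q₀ q′ ++ʷ row-walk strongG r p₀ p′
      from-hub (inj₂ c) = row-walk strongG r₀ p₀ p′ ++ʷ column-walk strongH c q₀ q′

  row-strong : Strong G → ∀ q → StronglyConnected (lines (_≡ q) (λ _ → ⊥))
  row-strong strongG q (p , _) (p′ , _) (inj₁ refl) (inj₁ refl) = row-walk strongG refl p p′

  column-strong : Strong H → ∀ p → StronglyConnected (lines (λ _ → ⊥) (_≡ p))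
  column-strong strongH p (_ , q) (_ , q′) (inj₂ refl) (inj₂ refl) = column-walk strongH refl q q′

  lines-disjoint : Loopless G → ∀ {R₁ C₁ R₂ C₂} →
                   (∀ q → R₁ q → ¬ R₂ q) → (∀ p → C₁ p → ¬ C₂ p) →
                   ∀ u v → ¬ (LineArc R₁ C₁ u v × LineArc R₂ C₂ u v)
  lines-disjoint loopless rows cols (_ , q) _ (inj₁ (_ , _ , r₁) , inj₁ (_ , _ , r₂)) = rows q r₁ r₂
  lines-disjoint loopless rows cols (p , _) _ (inj₂ (_ , _ , c₁) , inj₂ (_ , _ , c₂)) = cols p c₁ c₂
  lines-disjoint loopless rows cols _ _ (inj₁ (a , _ , _) , inj₂ (refl , _ , _)) = loopless a
  lines-disjoint loopless rows cols _ _ (inj₂ (refl , _ , _) , inj₁ (a , _ , _)) = loopless a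

  product-packing-of-two : Strong G → Strong H → Loopless G →
                           DecidableEquality (V G) → DecidableEquality (V H) →
                           NonTrivial (V G) → NonTrivial (V H) →
                           ∀ x y → x ≢ y → HasPacking (G □ H) x y 2
  product-packing-of-two sG sH loopless _≟G_ _≟H_ otherG otherH (a , b) (c , d) x≢y
    with a ≟G c | b ≟H d
  ... | yes refl | yes refl = ⊥-elim (x≢y refl)
  ... | no a≢c | no b≢d =
    packing-of-two (lines (_≡ b) (_≡ c)) (lines (_≡ d) (_≡ a))
      (inj₁ refl , inj₂ refl , lines-strong sG sH refl refl)
      (inj₂ refl , inj₁ refl , lines-strong sG sH refl refl)
      (lines-disjoint loopless (λ { _ refl → b≢d }) (λ { _ refl → ≢-sym a≢c }))
  ... | yes refl | no b≢d with otherG a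
  ...   | a′ , a′≢a =
    packing-of-two (lines (λ _ → ⊥) (_≡ a)) (lines (λ q → q ≡ b ⊎ q ≡ d) (_≡ a′))
      (inj₂ refl , inj₂ refl , column-strong sH a)
      (inj₁ (inj₁ refl) , inj₁ (inj₂ refl) , lines-strong sG sH (inj₁ refl) refl)
      (lines-disjoint loopless (λ _ ()) (λ { _ refl → ≢-sym a′≢a }))
  product-packing-of-two sG sH loopless _≟G_ _≟H_ otherG otherH (a , b) (c , d) x≢y
      | no a≢c | yes refl with otherH b
  ...   | b′ , b′≢b =
    packing-of-two (lines (_≡ b) (λ _ → ⊥)) (lines (_≡ b′) (λ p → p ≡ a ⊎ p ≡ c))
      (inj₁ refl , inj₁ refl , row-strong sG b)
      (inj₂ (inj₁ refl) , inj₂ (inj₂ refl) , lines-strong sG sH refl (inj₁ refl))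
      (lines-disjoint loopless (λ { _ refl → ≢-sym b′≢b }) (λ _ ()))

cycle-product-arc-from-origin : ∀ {n m v} → Arc (Cycle (suc (suc n)) □ Cycle (suc (suc m))) (fzero , fzero) v →
                                v ≡ (fsuc fzero , fzero) ⊎ v ≡ (fzero , fsuc fzero)
cycle-product-arc-from-origin {v = _ , _} (inj₁ (a , refl)) = inj₁ (cong (_, fzero) (cycle-arc-from-zero a))
cycle-product-arc-from-origin {v = _ , _} (inj₂ (refl , a)) = inj₂ (cong (fzero ,_) (cycle-arc-from-zero a))

proposition5p1 : (n m : ℕ) → 2 ≤ n → 2 ≤ m → Lambda2≡ (Cycle n □ Cycle m) 2
proposition5p1 (suc (suc n)) (suc (suc m)) (s≤s (s≤s z≤n)) (s≤s (s≤s z≤n)) =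
  product-packing-of-two (cycle-strong (suc n)) (cycle-strong (suc m)) (cycle-loopless n) _≟_ _≟_
                         (fin-nonTrivial n) (fin-nonTrivial m)
  , (fzero , fzero) , (fsuc fzero , fzero) , (λ ())
  , ¬packing-of-three-if-out-degree-two (λ ()) cycle-product-arc-from-origin
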